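{- There exist a function $f(k)\in \Omega(\sqrt{k})$ and an infinite class $\mathcal{G}$ of graphs such that for each $G\in \mathcal{G}$ with feedback edge number $k$, the twin-width of $G$ is at least $f(k)$.
   Context: The feedback edge number of a graph $G$ is the minimum size of an edge set $F$ such that $G-F$ is acyclic. A trigraph is a graph whose edge set is partitioned into black and red edges; a graph is viewed as a trigraph with only black edges. Contracting two distinct vertices $u,v$ of a trigraph produces a new trigraph by removing $u,v$ and adding a new vertex $w$, with a black edge $wx$ for each $x$ such that $xu$ and $xv$ are both black edges, and a red edge $wy$ for each $y$ such that $yu$ or $yv$ is red, or $y$ has a black edge to exactly one of $u,v$. A contraction sequence of a trigraph is a sequence of trigraphs starting at it, each obtained from the previous by one contraction, ending with a single-vertex trigraph. Its width is the maximum red degree of any vertex in any trigraph of the sequence. The twin-width is the minimum width of a contraction sequence. -}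

module Defs where

open import Data.Nat using (ℕ; zero; suc; _+_; _*_; _≤_; _<_; _<ᵇ_; _⊔_)
open import Data.Bool using (Bool; true; false; _∧_; _∨_; _xor_; not; if_then_else_)
open import Data.Fin using (Fin; toℕ; inject₁; fromℕ) renaming (zero to fzero; suc to fsuc)
open import Data.List using (List; map; foldr; allFin)
open import Data.Nat.ListAction using (sum)
open import Data.Product using (Σ; _×_; _,_)
open import Data.Sum using (_⊎_)
open import Relation.Binary.PropositionalEquality using (_≡_; _≢_)
open import Relation.Nullary using (¬_)
open import Function.Definitions using (Injective; Surjective)

record Graph (n : ℕ) : Set where
  field
    adj    : Fin n → Fin n → Bool
    sym    : ∀ x y → adj x y ≡ adj y x
    irrefl : ∀ x → adj x x ≡ false
open Graph public

countPairs : ∀ {n} → (Fin n → Fin n → Bool) → ℕ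
countPairs {n} R =
  sum (map (λ i → sum (map (λ j → if (toℕ i <ᵇ toℕ j) ∧ R i j then 1 else 0)
                               (allFin n)))
           (allFin n))

record Cycle {n : ℕ} (G : Graph n) : Set where
  field
    m      : ℕ
    v      : Fin (suc (suc (suc m))) → Fin n
    inj    : Injective _≡_ _≡_ v
    step   : ∀ (i : Fin (suc (suc m))) → adj G (v (inject₁ i)) (v (fsuc i)) ≡ true
    close  : adj G (v (fromℕ (suc (suc m)))) (v fzero) ≡ true

Acyclic : ∀ {n} → Graph n → Set
Acyclic G = ¬ Cycle G

record EdgeSet {n : ℕ} (G : Graph n) : Set where
  field
    mem  : Fin n → Fin n → Bool
    msym : ∀ x y → mem x y ≡ mem y x
    sub  : ∀ x y → mem x y ≡ true → adj G x y ≡ true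
open EdgeSet public

size : ∀ {n} {G : Graph n} → EdgeSet G → ℕ
size F = countPairs (mem F)

_─_ : ∀ {n} (G : Graph n) → EdgeSet G → Graph n
_─_ {n} G F = record
  { adj    = λ x y → adj G x y ∧ not (mem F x y)
  ; sym    = λ x y → helper x y
  ; irrefl = λ x → irr x
  }
  where
  open import Relation.Binary.PropositionalEquality using (cong₂)
  helper : ∀ x y → (adj G x y ∧ not (mem F x y)) ≡ (adj G y x ∧ not (mem F y x))
  helper x y = cong₂ (λ a b → a ∧ not b) (Graph.sym G x y) (msym F x y)
  irr : ∀ x → (adj G x x ∧ not (mem F x x)) ≡ false
  irr x with adj G x x | Graph.irrefl G x
  ... | .false | _≡_.refl = _≡_.refl

IsFeedbackEdgeNumber : ∀ {n} → Graph n → ℕ → Set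
IsFeedbackEdgeNumber G k =
  Σ (EdgeSet G) (λ F → size F ≡ k × Acyclic (G ─ F))
  × (∀ (F : EdgeSet G) → Acyclic (G ─ F) → k ≤ size F)

record Trigraph (n : ℕ) : Set where
  field
    black     : Fin n → Fin n → Bool
    red       : Fin n → Fin n → Bool
    bsym      : ∀ x y → black x y ≡ black y x
    rsym      : ∀ x y → red x y ≡ red y x
    birrefl   : ∀ x → black x x ≡ false
    rirrefl   : ∀ x → red x x ≡ false
    disjoint  : ∀ x y → (black x y ∧ red x y) ≡ false
open Trigraph public

toTrigraph : ∀ {n} → Graph n → Trigraph n
toTrigraph G = record
  { black = adj G ; red = λ _ _ → false
  ; bsym = Graph.sym G ; rsym = λ _ _ → _≡_.refl
  ; birrefl = Graph.irrefl G ; rirrefl = λ _ → _≡_.refl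
  ; disjoint = λ x y → lem (adj G x y) }
  where
  lem : ∀ b → (b ∧ false) ≡ false
  lem false = _≡_.refl
  lem true  = _≡_.refl

NotIn : ∀ {n} → Fin n → Fin n → Fin n → Set
NotIn u v x = x ≢ u × x ≢ v

-- T' is obtained from T by contracting two distinct vertices u, v into a
-- new vertex w = φ u = φ v; φ identifies the remaining vertices of T with
-- the vertices of T' other than w (vertex names of T' are up to relabelling).
record Contraction {n : ℕ} (T : Trigraph (suc n)) (T' : Trigraph n) : Set where
  field
    u v    : Fin (suc n)
    u≢v    : u ≢ v
    φ      : Fin (suc n) → Fin n
    φuv    : φ u ≡ φ v
    φsurj  : Surjective _≡_ _≡_ φ
    φinj   : ∀ x y → NotIn u v x → NotIn u v y → φ x ≡ φ y → x ≡ y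
    φnew   : ∀ x → NotIn u v x → φ x ≢ φ u
    keepB  : ∀ x y → NotIn u v x → NotIn u v y → black T' (φ x) (φ y) ≡ black T x y
    keepR  : ∀ x y → NotIn u v x → NotIn u v y → red T' (φ x) (φ y) ≡ red T x y
    newB   : ∀ x → NotIn u v x →
             black T' (φ u) (φ x) ≡ (black T u x ∧ black T v x)
    newR   : ∀ x → NotIn u v x →
             red T' (φ u) (φ x) ≡ (red T u x ∨ red T v x ∨ (black T u x xor black T v x))

data ContractionSeq : ∀ {n} → Trigraph n → Set where
  done : (T : Trigraph 1) → ContractionSeq T
  step : ∀ {n} {T : Trigraph (suc n)} {T' : Trigraph n} →
         Contraction T T' → ContractionSeq T' → ContractionSeq T

redDegree : ∀ {n} → Trigraph n → Fin n → ℕ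
redDegree {n} T x = sum (map (λ y → if red T x y then 1 else 0) (allFin n))

maxRedDegree : ∀ {n} → Trigraph n → ℕ
maxRedDegree {n} T = foldr _⊔_ 0 (map (redDegree T) (allFin n))

width : ∀ {n} {T : Trigraph n} → ContractionSeq T → ℕ
width (done T) = maxRedDegree T
width (step {T = T} _ s) = maxRedDegree T ⊔ width s

TwinWidthAtLeast : ∀ {n} → Graph n → ℕ → Set
TwinWidthAtLeast G t = ∀ (s : ContractionSeq (toTrigraph G)) → t ≤ width s

-- f ∈ Ω(√k): ∃ a,b > 0 and k₀ with f(k) ≥ (a/b)·√k for all k ≥ k₀,
-- i.e. a²·k ≤ b²·f(k)²
OmegaSqrt : (ℕ → ℕ) → Set
OmegaSqrt f = Σ ℕ λ a → Σ ℕ λ b → Σ ℕ λ k₀ →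
  0 < a × 0 < b × (∀ k → k₀ ≤ k → a * a * k ≤ b * b * (f k * f k))

-- a class of graphs (predicate on graphs), infinite in the sense of
-- containing graphs of arbitrarily large feedback edge number
GraphClass : Set₁
GraphClass = ∀ n → Graph n → Set

UnboundedFEN : GraphClass → Set
UnboundedFEN 𝒢 = ∀ N → Σ ℕ λ n → Σ (Graph n) λ G → 𝒢 n G ×
  Σ ℕ λ k → IsFeedbackEdgeNumber G k × N ≤ k

{-# OPTIONS --safe #-}
-- Let H be the Sylvester–Hadamard matrix of order 2^(d+1), and let G_d be the graph on its rows
-- (x ∼ y iff x ≠ y and H x y = −1) together with an apex adjacent to every row.  The apex edges
-- form a spanning star, so the feedback edge number k of G_d is the number of the remaining edges;
-- every row of H has at most 2^d entries −1, hence k ≤ 4^d, while k grows with d.  Two rows of H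
-- differ in exactly 2^d places and the apex differs from every row in at least 2^d places, so
-- whichever pair the first contraction of a sequence merges, the new vertex gets at least 2^d − 2
-- red edges.  Thus tww(G_d) ≥ 2^d − 2 ≥ ⌊√k⌋ − 2.
module Submission where

open import Defs
open import Data.Nat using (ℕ; zero; suc; _+_; _*_; _∸_; _≤_; _<_; _<ᵇ_; _⊔_; _≤?_; z≤n; s≤s; s≤s⁻¹)
open import Data.Nat.Properties
  using ( ≤-refl; ≤-trans; ≤-reflexive; <-irrefl; <⇒≤; <⇒≱; ≰⇒>; ≮⇒≥; ≤-<-trans; n≤1+n; n<1+n; m≤m+n; m≤n+m; m≤n*m
        ; m≤n⇒m<n∨m≡n; m≤n⇒∃[o]m+o≡n; m≤n+o⇒m∸n≤o; m≤m⊔n; m≤n⊔m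
        ; +-identityʳ; +-assoc; +-comm; +-suc; +-cancelˡ-≡; +-cancelˡ-≤; +-mono-≤; +-monoˡ-≤; +-monoʳ-≤
        ; *-identityˡ; *-suc; *-distribʳ-+; *-mono-≤; *-mono-<; *-cancelˡ-≤; [m*n]*[o*p]≡[m*o]*[n*p]
        ; ∸-monoˡ-≤; +-0-commutativeMonoid; module ≤-Reasoning)
import Data.Nat.ListAction as List
open import Data.Bool using (Bool; true; false; T; not; _∧_; _xor_; if_then_else_)
import Data.Bool.Properties as Bool
open import Data.Bool.Properties
  using ( T-∧; T-≡; ∧-zeroʳ; ∧-identityʳ; ∧-inverseʳ
        ; xor-comm; xor-identityʳ; xor-annihilates-not; not-distribˡ-xor; not-distribʳ-xor)
open import Data.Fin using (Fin; zero; suc; toℕ; fromℕ<; punchIn; splitAt; _↑ˡ_; _↑ʳ_)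
open import Data.Fin.Properties
  using ( _≟_; ¬∀⟶∃¬; pigeonhole; any?; suc-injective; 0≢1+n; toℕ-injective; toℕ≤pred[n]; toℕ-fromℕ<
        ; toℕ-inject₁; toℕ-fromℕ; punchInᵢ≢i; punchIn-injective; splitAt-↑ˡ; splitAt-↑ʳ; join-splitAt)
open import Data.List using (map; allFin; tabulate; foldr)
open import Data.List.Properties using (map-tabulate)
open import Data.List.Membership.Propositional using (_∈_)
open import Data.List.Membership.Propositional.Properties using (∈-map⁺; ∈-allFin)
open import Data.List.Relation.Unary.Any using (here; there)
open import Data.Product using (Σ; _×_; _,_; proj₁; proj₂)
open import Data.Sum using (_⊎_; inj₁; inj₂)
open import Data.Unit using (tt)
open import Data.Empty using (⊥-elim)
open import Function using (_∘_; id; Equivalence)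
open import Relation.Nullary.Decidable using (Dec; yes; no; does; ¬?; _×-dec_; dec-true; dec-false)
open import Relation.Binary.PropositionalEquality as ≡
  using (_≡_; _≢_; refl; cong; cong₂; trans; subst; subst₂; module ≡-Reasoning)
open import Algebra.Properties.CommutativeMonoid.Sum +-0-commutativeMonoid
  using (sum; sum-syntax; sum-cong-≗; sum-remove; sum-replicate-zero; ∑-distrib-+; ∑-comm)

sum-tabulate : ∀ {n} (g : Fin n → ℕ) → List.sum (tabulate g) ≡ sum g
sum-tabulate {zero}  g = refl
sum-tabulate {suc n} g = cong (g zero +_) (sum-tabulate (g ∘ suc))

sum-allFin : ∀ {n} (g : Fin n → ℕ) → List.sum (map g (allFin n)) ≡ sum g
sum-allFin g = trans (cong List.sum (map-tabulate id g)) (sum-tabulate g)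

∑-mono-≤ : ∀ {n} {f g : Fin n → ℕ} → (∀ i → f i ≤ g i) → sum f ≤ sum g
∑-mono-≤ {zero}  f≤g = z≤n
∑-mono-≤ {suc n} f≤g = +-mono-≤ (f≤g zero) (∑-mono-≤ (f≤g ∘ suc))

∑-≤-* : ∀ {n c} {f : Fin n → ℕ} → (∀ i → f i ≤ c) → sum f ≤ n * c
∑-≤-* {zero}  f≤c = z≤n
∑-≤-* {suc n} f≤c = +-mono-≤ (f≤c zero) (∑-≤-* (f≤c ∘ suc))

≤-∑ : ∀ {n} (f : Fin n → ℕ) i → f i ≤ sum f
≤-∑ {suc n} f i = ≤-trans (m≤m+n (f i) _) (≤-reflexive (≡.sym (sum-remove f)))

∑-↑ : ∀ m {n} (f : Fin (m + n) → ℕ) →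
      sum f ≡ ∑[ i < m ] f (i ↑ˡ n) + ∑[ j < n ] f (m ↑ʳ j)
∑-↑ zero    f = refl
∑-↑ (suc m) f = trans (cong (f zero +_) (∑-↑ m (f ∘ suc))) (≡.sym (+-assoc (f zero) _ _))

ind : Bool → ℕ
ind b = if b then 1 else 0

count : ∀ {n} → (Fin n → Bool) → ℕ
count {n} p = ∑[ i < n ] ind (p i)

_==_ : ∀ {n} → Fin n → Fin n → Bool
x == y = does (x ≟ y)

==-refl : ∀ {n} (x : Fin n) → (x == x) ≡ true
==-refl x = dec-true (x ≟ x) refl

≢⇒T-not-== : ∀ {n} {x y : Fin n} → x ≢ y → T (not (x == y))
≢⇒T-not-== {x = x} {y} x≢y = subst (T ∘ not) (≡.sym (dec-false (x ≟ y) x≢y)) tt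

T-not-==⇒≢ : ∀ {n} {x y : Fin n} → T (not (x == y)) → x ≢ y
T-not-==⇒≢ {x = x} t refl = subst (T ∘ not) (==-refl x) t

==-sym : ∀ {n} (x y : Fin n) → (x == y) ≡ (y == x)
==-sym x y with x ≟ y | y ≟ x
... | yes _   | yes _   = refl
... | no  _   | no  _   = refl
... | yes x≡y | no  y≢x = ⊥-elim (y≢x (≡.sym x≡y))
... | no  x≢y | yes y≡x = ⊥-elim (x≢y (≡.sym y≡x))

count-cong : ∀ {n} {p q : Fin n → Bool} → (∀ x → p x ≡ q x) → count p ≡ count q
count-cong p≗q = sum-cong-≗ (cong ind ∘ p≗q)

count-mono : ∀ {n} {p q : Fin n → Bool} → (∀ {x} → T (p x) → T (q x)) → count p ≤ count q
count-mono {p = p} {q} p⇒q = ∑-mono-≤ (λ x → ind-mono (p x) (q x) p⇒q)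
  where
  ind-mono : ∀ a b → (T a → T b) → ind a ≤ ind b
  ind-mono false b     _   = z≤n
  ind-mono true  true  _   = ≤-refl
  ind-mono true  false a⇒b = ⊥-elim (a⇒b tt)

count-false : ∀ n → count {n} (λ _ → false) ≡ 0
count-false n = sum-replicate-zero n

count-true : ∀ n → count {n} (λ _ → true) ≡ n
count-true zero    = refl
count-true (suc n) = cong suc (count-true n)

count-not : ∀ {n} (p : Fin n → Bool) → count p + count (not ∘ p) ≡ n
count-not {n} p = begin
  count p + count (not ∘ p)         ≡⟨ ∑-distrib-+ (ind ∘ p) (ind ∘ not ∘ p) ⟨
  ∑[ i < n ] (ind (p i) + ind (not (p i))) ≡⟨ sum-cong-≗ (λ i → ind-excluded-middle (p i)) ⟩
  count {n} (λ _ → true)            ≡⟨ count-true n ⟩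
  n                                 ∎
  where
  open ≡-Reasoning
  ind-excluded-middle : ∀ b → ind b + ind (not b) ≡ 1
  ind-excluded-middle false = refl
  ind-excluded-middle true  = refl

count-remove : ∀ {n} (p : Fin n → Bool) y → count p ≡ ind (p y) + count (λ x → p x ∧ not (x == y))
count-remove {suc n} p y = begin
  count p                                          ≡⟨ sum-cong-≗ (λ x → ind-split (p x) (x == y)) ⟩
  ∑[ x < suc n ] (ind (p x ∧ (x == y)) + ind (p x ∧ not (x == y)))
                                                   ≡⟨ ∑-distrib-+ (λ x → ind (p x ∧ (x == y))) (λ x → ind (p x ∧ not (x == y))) ⟩
  count (λ x → p x ∧ (x == y)) + count (λ x → p x ∧ not (x == y))
                                                   ≡⟨ cong (_+ count (λ x → p x ∧ not (x == y))) count-at ⟩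
  ind (p y) + count (λ x → p x ∧ not (x == y))    ∎
  where
  open ≡-Reasoning
  ind-split : ∀ a b → ind a ≡ ind (a ∧ b) + ind (a ∧ not b)
  ind-split false b     = refl
  ind-split true  false = refl
  ind-split true  true  = refl
  count-at : count (λ x → p x ∧ (x == y)) ≡ ind (p y)
  count-at = begin
    count (λ x → p x ∧ (x == y))   ≡⟨ sum-remove (λ x → ind (p x ∧ (x == y))) ⟩
    ind (p y ∧ (y == y)) + ∑[ i < n ] ind (p (punchIn y i) ∧ (punchIn y i == y))
                                   ≡⟨ cong₂ _+_ (cong (ind ∘ (p y ∧_)) (==-refl y)) (sum-cong-≗ off-y) ⟩
    ind (p y ∧ true) + count {n} (λ _ → false)
                                   ≡⟨ cong₂ _+_ (cong ind (∧-identityʳ (p y))) (count-false n) ⟩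
    ind (p y) + 0                  ≡⟨ +-identityʳ _ ⟩
    ind (p y)                      ∎
    where
    off-y : ∀ i → ind (p (punchIn y i) ∧ (punchIn y i == y)) ≡ 0
    off-y i = trans (cong (ind ∘ (p (punchIn y i) ∧_)) (dec-false (punchIn y i ≟ y) (punchInᵢ≢i y i)))
                    (cong ind (∧-zeroʳ _))

count-except : ∀ {n} {p q : Fin n → Bool} y → (∀ {x} → x ≢ y → T (p x) → T (q x)) → count p ≤ suc (count q)
count-except {p = p} {q} y p⇒q = begin
  count p                                      ≡⟨ count-remove p y ⟩
  ind (p y) + count (λ x → p x ∧ not (x == y))
    ≤⟨ +-mono-≤ (ind≤1 (p y)) (count-mono {p = λ x → p x ∧ not (x == y)} p∖y⇒q) ⟩
  suc (count q)                                ∎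
  where
  open ≤-Reasoning
  ind≤1 : ∀ b → ind b ≤ 1
  ind≤1 false = z≤n
  ind≤1 true  = ≤-refl
  p∖y⇒q : ∀ {x} → T (p x ∧ not (x == y)) → T (q x)
  p∖y⇒q pxy with px , x≢y ← Equivalence.to T-∧ pxy = p⇒q (T-not-==⇒≢ x≢y) px

count-≤-injective : ∀ {m n} {p : Fin m → Bool} {q : Fin n → Bool} (g : Fin m → Fin n) →
                    (∀ {x y} → T (p x) → T (p y) → g x ≡ g y → x ≡ y) →
                    (∀ {x} → T (p x) → T (q (g x))) → count p ≤ count q
count-≤-injective {zero}  g _ _ = z≤n
count-≤-injective {suc m} {p = p} {q} g inj p⇒q with p zero in p₀
... | false = count-≤-injective (g ∘ suc) (λ px py → suc-injective ∘ inj px py) p⇒q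
... | true  = begin
  suc (count (p ∘ suc))        ≤⟨ s≤s (count-≤-injective (g ∘ suc) (λ px py → suc-injective ∘ inj px py) p⇒q′) ⟩
  suc (count q′)               ≡⟨ cong (_+ count q′) (cong ind (Equivalence.to T-≡ (p⇒q p₀-holds))) ⟨
  ind (q (g zero)) + count q′  ≡⟨ count-remove q (g zero) ⟨
  count q                      ∎
  where
  open ≤-Reasoning
  p₀-holds : T (p zero)
  p₀-holds = subst T (≡.sym p₀) tt
  q′ : _ → Bool
  q′ y = q y ∧ not (y == g zero)
  p⇒q′ : ∀ {x} → T (p (suc x)) → T (q′ (g (suc x)))
  p⇒q′ px = Equivalence.from T-∧ (p⇒q px , ≢⇒T-not-== (λ e → 0≢1+n (inj p₀-holds px (≡.sym e))))

countPairs-∑ : ∀ {n} (R : Fin n → Fin n → Bool) →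
               countPairs R ≡ ∑[ i < n ] count (λ j → (toℕ i <ᵇ toℕ j) ∧ R i j)
countPairs-∑ {n} R =
  trans (sum-allFin (λ i → List.sum (map (λ j → ind ((toℕ i <ᵇ toℕ j) ∧ R i j)) (allFin n))))
        (sum-cong-≗ (λ i → sum-allFin (λ j → ind ((toℕ i <ᵇ toℕ j) ∧ R i j))))

count₂ : ∀ {n} → (Fin n → Fin n → Bool) → ℕ
count₂ {n} R = ∑[ x < n ] count (R x)

<ᵇ-trichotomy : ∀ a b → a ≡ b ⊎ ((a <ᵇ b) ≡ true × (b <ᵇ a) ≡ false)
                            ⊎ ((a <ᵇ b) ≡ false × (b <ᵇ a) ≡ true)
<ᵇ-trichotomy zero    zero    = inj₁ refl
<ᵇ-trichotomy zero    (suc b) = inj₂ (inj₁ (refl , refl))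
<ᵇ-trichotomy (suc a) zero    = inj₂ (inj₂ (refl , refl))
<ᵇ-trichotomy (suc a) (suc b) with <ᵇ-trichotomy a b
... | inj₁ a≡b   = inj₁ (cong suc a≡b)
... | inj₂ order = inj₂ order

count₂≡2*countPairs : ∀ {n} (R : Fin n → Fin n → Bool) →
                      (∀ x y → R x y ≡ R y x) → (∀ x → R x x ≡ false) → count₂ R ≡ 2 * countPairs R
count₂≡2*countPairs {n} R R-sym R-irrefl = begin
  count₂ R
    ≡⟨ sum-cong-≗ (λ i → trans (sum-cong-≗ (split i))
                               (∑-distrib-+ (λ j → ind (upper i j)) (λ j → ind (upper j i)))) ⟩
  ∑[ i < n ] (∑[ j < n ] ind (upper i j) + ∑[ j < n ] ind (upper j i))
    ≡⟨ ∑-distrib-+ (λ i → ∑[ j < n ] ind (upper i j)) (λ i → ∑[ j < n ] ind (upper j i)) ⟩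
  ∑[ i < n ] ∑[ j < n ] ind (upper i j) + ∑[ i < n ] ∑[ j < n ] ind (upper j i)
    ≡⟨ cong (∑[ i < n ] ∑[ j < n ] ind (upper i j) +_) (∑-comm (λ i j → ind (upper j i))) ⟩
  ∑[ i < n ] ∑[ j < n ] ind (upper i j) + ∑[ j < n ] ∑[ i < n ] ind (upper j i)
    ≡⟨ cong₂ _+_ (countPairs-∑ R) (countPairs-∑ R) ⟨
  countPairs R + countPairs R
    ≡⟨ cong (countPairs R +_) (+-identityʳ _) ⟨
  2 * countPairs R ∎
  where
  open ≡-Reasoning
  upper : Fin n → Fin n → Bool
  upper i j = (toℕ i <ᵇ toℕ j) ∧ R i j
  split : ∀ i j → ind (R i j) ≡ ind (upper i j) + ind (upper j i)
  split i j with <ᵇ-trichotomy (toℕ i) (toℕ j)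
  ... | inj₁ i≡j rewrite toℕ-injective i≡j | R-irrefl j | ∧-zeroʳ (toℕ j <ᵇ toℕ j) = refl
  ... | inj₂ (inj₁ (i<j , j≮i)) rewrite i<j | j≮i = ≡.sym (+-identityʳ _)
  ... | inj₂ (inj₂ (i≮j , j<i)) rewrite i≮j | j<i | R-sym i j = refl

count₂-edgeSet : ∀ {n} {G : Graph n} (F : EdgeSet G) → count₂ (mem F) ≡ 2 * size F
count₂-edgeSet {G = G} F = count₂≡2*countPairs (mem F) (msym F) loopless
  where
  loopless : ∀ x → mem F x x ≡ false
  loopless x with mem F x x in e
  ... | false = refl
  ... | true with () ← trans (≡.sym (Graph.irrefl G x)) (sub F x x e)

InjectiveUpTo : ∀ {n} → (ℕ → Fin n) → ℕ → Set
InjectiveUpTo w j = ∀ {a b} → a ≤ j → b ≤ j → w a ≡ w b → a ≡ b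

record FirstRepeat {n} (w : ℕ → Fin n) : Set where
  field
    i j      : ℕ
    i≤j      : i ≤ j
    repeats  : w i ≡ w (suc j)
    distinct : InjectiveUpTo w j

injectiveUpTo⊎firstRepeat : ∀ {n} (w : ℕ → Fin n) j → InjectiveUpTo w j ⊎ FirstRepeat w
injectiveUpTo⊎firstRepeat w zero = inj₁ (λ { z≤n z≤n _ → refl })
injectiveUpTo⊎firstRepeat w (suc j) with injectiveUpTo⊎firstRepeat w j
... | inj₂ r        = inj₂ r
... | inj₁ distinct with any? (λ (i : Fin (suc j)) → w (toℕ i) ≟ w (suc j))
...   | yes (i , e) = inj₂ record { i≤j = toℕ≤pred[n] i ; repeats = e ; distinct = distinct }
...   | no new      = inj₁ distinct′
  where
  old : ∀ {a} → a ≤ j → w a ≢ w (suc j)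
  old a≤j e = new (fromℕ< (s≤s a≤j) , subst (λ t → w t ≡ w (suc j)) (≡.sym (toℕ-fromℕ< (s≤s a≤j))) e)
  distinct′ : InjectiveUpTo w (suc j)
  distinct′ a≤ b≤ e with m≤n⇒m<n∨m≡n a≤ | m≤n⇒m<n∨m≡n b≤
  ... | inj₁ a<   | inj₁ b<   = distinct (s≤s⁻¹ a<) (s≤s⁻¹ b<) e
  ... | inj₁ a<   | inj₂ refl = ⊥-elim (old (s≤s⁻¹ a<) e)
  ... | inj₂ refl | inj₁ b<   = ⊥-elim (old (s≤s⁻¹ b<) (≡.sym e))
  ... | inj₂ refl | inj₂ refl = refl

firstRepeat : ∀ {n} (w : ℕ → Fin n) → FirstRepeat w
firstRepeat {n} w with injectiveUpTo⊎firstRepeat w n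
... | inj₂ r        = r
... | inj₁ distinct with i , j , i<j , wi≡wj ← pigeonhole ≤-refl (w ∘ toℕ) =
  ⊥-elim (<-irrefl (distinct (toℕ≤pred[n] i) (toℕ≤pred[n] j) wi≡wj) i<j)

record NonBacktrackingWalk {n} (G : Graph n) : Set where
  field
    w          : ℕ → Fin n
    walks      : ∀ k → adj G (w k) (w (suc k)) ≡ true
    noBacktrack : ∀ k → w (suc (suc k)) ≢ w k

module _ {n} {G : Graph n} (W : NonBacktrackingWalk G) where
  open NonBacktrackingWalk W

  private
    Edge : Fin n → Fin n → Set
    Edge x y = adj G x y ≡ true

  -- A closed segment of length 1 would be a loop and one of length 2 a backtrack.
  closedWalk⇒cycle : ∀ i o → w i ≡ w (suc (i + o)) → InjectiveUpTo w (i + o) → Cycle G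
  closedWalk⇒cycle i zero back _
    with () ← trans (≡.sym (Graph.irrefl G (w i)))
                    (subst₂ Edge (cong w (+-identityʳ i)) (≡.sym back) (walks (i + 0)))
  closedWalk⇒cycle i (suc zero) back _ =
    ⊥-elim (noBacktrack i (≡.sym (trans back (cong (w ∘ suc) (+-comm i 1)))))
  closedWalk⇒cycle i (suc (suc m)) back distinct = record
    { m     = m
    ; v     = v
    ; inj   = λ {a} {b} e → toℕ-injective (+-cancelˡ-≡ i _ _
                (distinct (+-monoʳ-≤ i (toℕ≤pred[n] a)) (+-monoʳ-≤ i (toℕ≤pred[n] b)) e))
    ; step  = λ k → subst₂ Edge (cong (λ t → w (i + t)) (≡.sym (toℕ-inject₁ k)))
                                (cong w (≡.sym (+-suc i (toℕ k))))
                                (walks (i + toℕ k))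
    ; close = subst₂ Edge (cong (λ t → w (i + t)) (≡.sym (toℕ-fromℕ (suc (suc m)))))
                          (trans (≡.sym back) (cong w (≡.sym (+-identityʳ i))))
                          (walks (i + suc (suc m)))
    }
    where
    v : Fin (suc (suc (suc m))) → Fin n
    v k = w (i + toℕ k)

  nonBacktrackingWalk⇒cycle : Cycle G
  nonBacktrackingWalk⇒cycle with firstRepeat w
  ... | record { i = i ; i≤j = i≤j ; repeats = repeats ; distinct = distinct }
    with o , refl ← m≤n⇒∃[o]m+o≡n i≤j = closedWalk⇒cycle i o repeats distinct

TwoNeighbours : ∀ {n} → Graph n → Fin n → Set
TwoNeighbours G x = Σ _ λ a → Σ _ λ b → a ≢ b × adj G x a ≡ true × adj G x b ≡ true

twoNeighbours? : ∀ {n} (G : Graph n) x → Dec (TwoNeighbours G x)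
twoNeighbours? G x =
  any? λ a → any? λ b → ¬? (a ≟ b) ×-dec (adj G x a Bool.≟ true) ×-dec (adj G x b Bool.≟ true)

module _ {n} (G : Graph n) (branching : ∀ x → TwoNeighbours G x) where

  otherNeighbour : ∀ p c → Σ (Fin n) λ y → adj G c y ≡ true × y ≢ p
  otherNeighbour p c with branching c
  ... | a , b , a≢b , ca , cb with a ≟ p
  ...   | yes refl = b , cb , a≢b ∘ ≡.sym
  ...   | no  a≢p  = a , ca , a≢p

  branching⇒walk : Fin n → NonBacktrackingWalk G
  branching⇒walk x₀ = record
    { w = proj₁ ∘ edge ; walks = walks ; noBacktrack = λ k → proj₂ (proj₂ (next k)) }
    where
    edge : ℕ → Fin n × Fin n
    next : ∀ k → Σ (Fin n) λ y → adj G (proj₂ (edge k)) y ≡ true × y ≢ proj₁ (edge k)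
    edge zero    = x₀ , proj₁ (branching x₀)
    edge (suc k) = proj₂ (edge k) , proj₁ (next k)
    next k = otherNeighbour (proj₁ (edge k)) (proj₂ (edge k))
    walks : ∀ k → adj G (proj₁ (edge k)) (proj₁ (edge (suc k))) ≡ true
    walks zero    = proj₁ (proj₂ (proj₂ (proj₂ (branching x₀))))
    walks (suc k) = proj₁ (proj₂ (next k))

acyclic⇒leaf : ∀ {n} (G : Graph (suc n)) → Acyclic G → Σ (Fin (suc n)) λ x → count (adj G x) ≤ 1
acyclic⇒leaf G acyclic
  with x , ¬two ← ¬∀⟶∃¬ _ (TwoNeighbours G) (twoNeighbours? G)
                    (λ branching → acyclic (nonBacktrackingWalk⇒cycle (branching⇒walk G branching zero)))
  = x , count-≤-injective {q = λ (_ : Fin 1) → true} (λ _ → zero) unique (λ _ → tt)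
  where
  unique : ∀ {a b} → T (adj G x a) → T (adj G x b) → zero ≡ zero → a ≡ b
  unique {a} {b} xa xb _ with a ≟ b
  ... | yes a≡b = a≡b
  ... | no  a≢b = ⊥-elim (¬two (a , b , a≢b , Equivalence.to T-≡ xa , Equivalence.to T-≡ xb))

_∖_ : ∀ {n} → Graph (suc n) → Fin (suc n) → Graph n
G ∖ x = record
  { adj    = λ a b → adj G (punchIn x a) (punchIn x b)
  ; sym    = λ a b → Graph.sym G (punchIn x a) (punchIn x b)
  ; irrefl = λ a → Graph.irrefl G (punchIn x a)
  }

acyclic-∖ : ∀ {n} (G : Graph (suc n)) x → Acyclic G → Acyclic (G ∖ x)
acyclic-∖ G x acyclic c = acyclic record
  { m     = Cycle.m c
  ; v     = punchIn x ∘ Cycle.v c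
  ; inj   = Cycle.inj c ∘ punchIn-injective x _ _
  ; step  = Cycle.step c
  ; close = Cycle.close c
  }

count₂-∖ : ∀ {n} (G : Graph (suc n)) x →
           count₂ (adj G) ≡ count (adj G x) + count (adj G x) + count₂ (adj (G ∖ x))
count₂-∖ {n} G x = begin
  count₂ (adj G)
    ≡⟨ sum-remove (λ y → count (adj G y)) ⟩
  count (adj G x) + ∑[ a < n ] count (adj G (punchIn x a))
    ≡⟨ cong (count (adj G x) +_) (sum-cong-≗ (λ a → sum-remove (λ y → ind (adj G (punchIn x a) y)))) ⟩
  count (adj G x) + ∑[ a < n ] (ind (adj G (punchIn x a) x) + count (adj (G ∖ x) a))
    ≡⟨ cong (count (adj G x) +_) (∑-distrib-+ (λ a → ind (adj G (punchIn x a) x)) (count ∘ adj (G ∖ x))) ⟩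
  count (adj G x) + (∑[ a < n ] ind (adj G (punchIn x a) x) + count₂ (adj (G ∖ x)))
    ≡⟨ cong (λ c → count (adj G x) + (c + count₂ (adj (G ∖ x)))) column ⟩
  count (adj G x) + (count (adj G x) + count₂ (adj (G ∖ x)))
    ≡⟨ +-assoc (count (adj G x)) _ _ ⟨
  count (adj G x) + count (adj G x) + count₂ (adj (G ∖ x)) ∎
  where
  open ≡-Reasoning
  column : ∑[ a < n ] ind (adj G (punchIn x a) x) ≡ count (adj G x)
  column = begin
    ∑[ a < n ] ind (adj G (punchIn x a) x)
      ≡⟨ sum-cong-≗ (λ a → cong ind (Graph.sym G (punchIn x a) x)) ⟩
    ∑[ a < n ] ind (adj G x (punchIn x a))
      ≡⟨ cong (λ b → ind b + ∑[ a < n ] ind (adj G x (punchIn x a))) (Graph.irrefl G x) ⟨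
    ind (adj G x x) + ∑[ a < n ] ind (adj G x (punchIn x a))
      ≡⟨ sum-remove (ind ∘ adj G x) ⟨
    count (adj G x) ∎

acyclic⇒count₂≤ : ∀ {n} (G : Graph (suc n)) → Acyclic G → count₂ (adj G) ≤ 2 * n
acyclic⇒count₂≤ {zero} G _ rewrite Graph.irrefl G zero = z≤n
acyclic⇒count₂≤ {suc n} G acyclic with x , leaf ← acyclic⇒leaf G acyclic = begin
  count₂ (adj G)                                            ≡⟨ count₂-∖ G x ⟩
  count (adj G x) + count (adj G x) + count₂ (adj (G ∖ x))  ≤⟨ +-mono-≤ (+-mono-≤ leaf leaf) forest ⟩
  2 + 2 * n                                                 ≡⟨ *-suc 2 n ⟨
  2 * suc n                                                 ∎
  where
  open ≤-Reasoning
  forest : count₂ (adj (G ∖ x)) ≤ 2 * n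
  forest = acyclic⇒count₂≤ (G ∖ x) (acyclic-∖ G x acyclic)

acyclic⇒countPairs≤ : ∀ {n} (G : Graph (suc n)) → Acyclic G → countPairs (adj G) ≤ n
acyclic⇒countPairs≤ {n} G acyclic =
  *-cancelˡ-≤ 2 (subst (_≤ 2 * n) (count₂≡2*countPairs (adj G) (Graph.sym G) (Graph.irrefl G))
                       (acyclic⇒count₂≤ G acyclic))

countPairs-─ : ∀ {n} {G : Graph n} (F : EdgeSet G) → countPairs (adj G) ≡ countPairs (adj (G ─ F)) + size F
countPairs-─ {n} {G} F = begin
  countPairs (adj G)
    ≡⟨ countPairs-∑ (adj G) ⟩
  ∑[ i < n ] count (λ j → lt i j ∧ adj G i j)
    ≡⟨ sum-cong-≗ (λ i → trans (sum-cong-≗ (λ j → split (lt i j) (adj G i j) (mem F i j) (sub F i j)))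
                               (∑-distrib-+ (λ j → ind (lt i j ∧ adj (G ─ F) i j)) (λ j → ind (lt i j ∧ mem F i j)))) ⟩
  ∑[ i < n ] (count (λ j → lt i j ∧ adj (G ─ F) i j) + count (λ j → lt i j ∧ mem F i j))
    ≡⟨ ∑-distrib-+ (λ i → count (λ j → lt i j ∧ adj (G ─ F) i j)) (λ i → count (λ j → lt i j ∧ mem F i j)) ⟩
  ∑[ i < n ] count (λ j → lt i j ∧ adj (G ─ F) i j) + ∑[ i < n ] count (λ j → lt i j ∧ mem F i j)
    ≡⟨ cong₂ _+_ (countPairs-∑ (adj (G ─ F))) (countPairs-∑ (mem F)) ⟨
  countPairs (adj (G ─ F)) + size F ∎
  where
  open ≡-Reasoning
  lt : Fin n → Fin n → Bool
  lt i j = toℕ i <ᵇ toℕ j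
  split : ∀ l a f → (f ≡ true → a ≡ true) → ind (l ∧ a) ≡ ind (l ∧ (a ∧ not f)) + ind (l ∧ f)
  split l a false _   rewrite ∧-identityʳ a | ∧-zeroʳ l = ≡.sym (+-identityʳ _)
  split l a true  f⇒a rewrite f⇒a refl | ∧-zeroʳ l = refl

spanningTree⇒isFeedbackEdgeNumber : ∀ {n} (G : Graph (suc n)) (F : EdgeSet G) →
  Acyclic (G ─ F) → countPairs (adj (G ─ F)) ≡ n → IsFeedbackEdgeNumber G (size F)
spanningTree⇒isFeedbackEdgeNumber {n} G F acyclic tree = (F , refl , acyclic) , minimal
  where
  minimal : ∀ F′ → Acyclic (G ─ F′) → size F ≤ size F′
  minimal F′ acyclic′ = +-cancelˡ-≤ n _ _ (begin
    n + size F                           ≡⟨ cong (_+ size F) tree ⟨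
    countPairs (adj (G ─ F)) + size F    ≡⟨ countPairs-─ F ⟨
    countPairs (adj G)                   ≡⟨ countPairs-─ F′ ⟩
    countPairs (adj (G ─ F′)) + size F′  ≤⟨ +-monoˡ-≤ (size F′) (acyclic⇒countPairs≤ (G ─ F′) acyclic′) ⟩
    n + size F′                          ∎)
    where open ≤-Reasoning

star⇒acyclic : ∀ {n} (G : Graph n) c → (∀ {x y} → adj G x y ≡ true → x ≡ c ⊎ y ≡ c) → Acyclic G
star⇒acyclic G c hub record { inj = inj ; step = edge ; close = closing }
  with hub (edge zero)
... | inj₁ v₀≡c with hub (edge (suc zero))
...   | inj₁ v₁≡c with () ← inj (trans v₀≡c (≡.sym v₁≡c))
...   | inj₂ v₂≡c with () ← inj (trans v₀≡c (≡.sym v₂≡c))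
star⇒acyclic G c hub record { inj = inj ; step = edge ; close = closing }
    | inj₂ v₁≡c with hub closing
...   | inj₁ vₗ≡c with () ← inj (trans v₁≡c (≡.sym vₗ≡c))
...   | inj₂ v₀≡c with () ← inj (trans v₀≡c (≡.sym v₁≡c))

≤-foldr-⊔ : ∀ {x xs} → x ∈ xs → x ≤ foldr _⊔_ 0 xs
≤-foldr-⊔ (here refl) = m≤m⊔n _ _
≤-foldr-⊔ (there x∈xs) = ≤-trans (≤-foldr-⊔ x∈xs) (m≤n⊔m _ _)

redDegree≤maxRedDegree : ∀ {n} (T : Trigraph n) x → redDegree T x ≤ maxRedDegree T
redDegree≤maxRedDegree T x = ≤-foldr-⊔ (∈-map⁺ (redDegree T) (∈-allFin x))

maxRedDegree≤width : ∀ {n} {T : Trigraph n} (s : ContractionSeq T) → maxRedDegree T ≤ width s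
maxRedDegree≤width (done T)   = ≤-refl
maxRedDegree≤width (step _ s) = m≤m⊔n _ _

width≥ : ∀ {n D} {T : Trigraph (suc n)} → 0 < n → (∀ {T′} → Contraction T T′ → D ≤ maxRedDegree T′) →
         (s : ContractionSeq T) → D ≤ width s
width≥ () _ (done _)
width≥ _ first (step {T = T} c s) =
  ≤-trans (first c) (≤-trans (maxRedDegree≤width s) (m≤n⊔m (maxRedDegree T) _))

distinguishers : ∀ {n} → Graph n → Fin n → Fin n → Fin n → Bool
distinguishers G u v x = (adj G u x xor adj G v x) ∧ (not (x == u) ∧ not (x == v))

distinguishers≤redDegree : ∀ {n} {G : Graph (suc n)} {T′ : Trigraph n} (c : Contraction (toTrigraph G) T′) →
  let open Contraction c in count (distinguishers G u v) ≤ redDegree T′ (φ u)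
distinguishers≤redDegree {G = G} {T′} c = begin
  count (distinguishers G u v)  ≤⟨ count-≤-injective φ (λ px py → φinj _ _ (outside px) (outside py)) becomesRed ⟩
  count (red T′ (φ u))          ≡⟨ sum-allFin (ind ∘ red T′ (φ u)) ⟨
  redDegree T′ (φ u)            ∎
  where
  open Contraction c
  open ≤-Reasoning
  split : ∀ {x} → T (distinguishers G u v x) → T (adj G u x xor adj G v x) × NotIn u v x
  split {x} d with xor , x∉ ← Equivalence.to (T-∧ {adj G u x xor adj G v x}) d
              with x≢u , x≢v ← Equivalence.to (T-∧ {not (x == u)}) x∉ =
    xor , T-not-==⇒≢ x≢u , T-not-==⇒≢ x≢v
  outside : ∀ {x} → T (distinguishers G u v x) → NotIn u v x
  outside = proj₂ ∘ split
  becomesRed : ∀ {x} → T (distinguishers G u v x) → T (red T′ (φ u) (φ x))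
  becomesRed {x} d = subst T (≡.sym (newR x (outside d))) (proj₁ (split d))

twinWidth≥ : ∀ {n D} (G : Graph (suc n)) → 0 < n → (∀ {u v} → u ≢ v → D ≤ count (distinguishers G u v)) →
             TwinWidthAtLeast G D
twinWidth≥ G 0<n distinguished = width≥ 0<n λ {T′} c → let open Contraction c in
  ≤-trans (distinguished u≢v) (≤-trans (distinguishers≤redDegree c) (redDegree≤maxRedDegree T′ (φ u)))

TwinWidthAtLeast-mono : ∀ {n} {G : Graph n} {s t} → s ≤ t → TwinWidthAtLeast G t → TwinWidthAtLeast G s
TwinWidthAtLeast-mono s≤t tw seq = ≤-trans s≤t (tw seq)

simpleGraph : ∀ {n} (M : Fin n → Fin n → Bool) → (∀ x y → M x y ≡ M y x) → Graph n
simpleGraph M M-sym = record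
  { adj    = λ x y → M x y ∧ not (x == y)
  ; sym    = λ x y → cong₂ (λ a b → a ∧ not b) (M-sym x y) (==-sym x y)
  ; irrefl = λ x → trans (cong (λ b → M x x ∧ not b) (==-refl x)) (∧-zeroʳ (M x x))
  }

distinguishers-simpleGraph : ∀ {n} (M : Fin n → Fin n → Bool) (M-sym : ∀ x y → M x y ≡ M y x) u v →
  count (λ x → M u x xor M v x) ≤ 2 + count (distinguishers (simpleGraph M M-sym) u v)
distinguishers-simpleGraph M M-sym u v =
  ≤-trans (count-except {p = differ} {q = differ∖u} u
             (λ x≢u dx → Equivalence.from (T-∧ {differ _}) (dx , ≢⇒T-not-== x≢u)))
          (s≤s (count-except {p = differ∖u} {q = distinguishers G u v} v distinguishes))
  where
  G = simpleGraph M M-sym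
  differ differ∖u : _ → Bool
  differ x = M u x xor M v x
  differ∖u x = differ x ∧ not (x == u)
  off-diagonal : ∀ {y x} → x ≢ y → adj G y x ≡ M y x
  off-diagonal {y} {x} x≢y =
    trans (cong (λ b → M y x ∧ not b) (dec-false (y ≟ x) (x≢y ∘ ≡.sym))) (∧-identityʳ _)
  distinguishes : ∀ {x} → x ≢ v → T (differ∖u x) → T (distinguishers G u v x)
  distinguishes {x} x≢v dx with d , x∉u ← Equivalence.to (T-∧ {differ x}) dx =
    Equivalence.from (T-∧ {adj G u x xor adj G v x})
      ( subst T (≡.sym (cong₂ _xor_ (off-diagonal (T-not-==⇒≢ x∉u)) (off-diagonal x≢v))) d
      , Equivalence.from (T-∧ {not (x == u)}) (x∉u , ≢⇒T-not-== x≢v))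

order : ℕ → ℕ
order zero    = 1
order (suc d) = order d + order d

n<order : ∀ n → n < order n
n<order zero    = s≤s z≤n
n<order (suc n) = +-mono-≤ (≤-trans (s≤s z≤n) (n<order n)) (n<order n)

sylvester : ∀ {m} → (Fin m → Fin m → Bool) → Fin m ⊎ Fin m → Fin m ⊎ Fin m → Bool
sylvester H (inj₁ a) (inj₁ b) = H a b
sylvester H (inj₁ a) (inj₂ b) = H a b
sylvester H (inj₂ a) (inj₁ b) = H a b
sylvester H (inj₂ a) (inj₂ b) = not (H a b)

-- Sylvester's recursion H ↦ [[H, H], [H, −H]], with true standing for the entry −1.
hadamard : ∀ d → Fin (order d) → Fin (order d) → Bool
hadamard zero    _ _ = false
hadamard (suc d) x y = sylvester (hadamard d) (splitAt (order d) x) (splitAt (order d) y)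

module _ (d : ℕ) (a b : Fin (order d)) where
  private
    m = order d

  hadamard-ˡˡ : hadamard (suc d) (a ↑ˡ m) (b ↑ˡ m) ≡ hadamard d a b
  hadamard-ˡˡ = cong₂ (sylvester (hadamard d)) (splitAt-↑ˡ m a m) (splitAt-↑ˡ m b m)

  hadamard-ˡʳ : hadamard (suc d) (a ↑ˡ m) (m ↑ʳ b) ≡ hadamard d a b
  hadamard-ˡʳ = cong₂ (sylvester (hadamard d)) (splitAt-↑ˡ m a m) (splitAt-↑ʳ m m b)

  hadamard-ʳˡ : hadamard (suc d) (m ↑ʳ a) (b ↑ˡ m) ≡ hadamard d a b
  hadamard-ʳˡ = cong₂ (sylvester (hadamard d)) (splitAt-↑ʳ m m a) (splitAt-↑ˡ m b m)

  hadamard-ʳʳ : hadamard (suc d) (m ↑ʳ a) (m ↑ʳ b) ≡ not (hadamard d a b)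
  hadamard-ʳʳ = cong₂ (sylvester (hadamard d)) (splitAt-↑ʳ m m a) (splitAt-↑ʳ m m b)

data Half (m : ℕ) : Fin (m + m) → Set where
  left  : (a : Fin m) → Half m (a ↑ˡ m)
  right : (a : Fin m) → Half m (m ↑ʳ a)

half : ∀ m x → Half m x
half m x with splitAt m x | join-splitAt m m x
... | inj₁ a | refl = left a
... | inj₂ a | refl = right a

count-halves : ∀ {m} (p : Fin (m + m) → Bool) → count p ≡ count (p ∘ (_↑ˡ m)) + count (p ∘ (m ↑ʳ_))
count-halves {m} p = ∑-↑ m (ind ∘ p)

hadamard-sym : ∀ d a b → hadamard d a b ≡ hadamard d b a
hadamard-sym zero    a b = refl
hadamard-sym (suc d) a b with half (order d) a | half (order d) b
... | left a  | left b  = trans (hadamard-ˡˡ d a b) (trans (hadamard-sym d a b) (≡.sym (hadamard-ˡˡ d b a)))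
... | left a  | right b = trans (hadamard-ˡʳ d a b) (trans (hadamard-sym d a b) (≡.sym (hadamard-ʳˡ d b a)))
... | right a | left b  = trans (hadamard-ʳˡ d a b) (trans (hadamard-sym d a b) (≡.sym (hadamard-ˡʳ d b a)))
... | right a | right b =
  trans (hadamard-ʳʳ d a b) (trans (cong not (hadamard-sym d a b)) (≡.sym (hadamard-ʳʳ d b a)))

hadamard-orthogonal : ∀ d {a b : Fin (order (suc d))} → a ≢ b →
  count (λ z → hadamard (suc d) a z xor hadamard (suc d) b z) ≡ order d
hadamard-orthogonal zero {zero}     {zero}     a≢b = ⊥-elim (a≢b refl)
hadamard-orthogonal zero {zero}     {suc zero} _   = refl
hadamard-orthogonal zero {suc zero} {zero}     _   = refl
hadamard-orthogonal zero {suc zero} {suc zero} a≢b = ⊥-elim (a≢b refl)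
hadamard-orthogonal (suc d) {a} {b} = orthogonal (half m a) (half m b)
  where
  m = order (suc d)
  h = hadamard (suc d)
  H = hadamard (suc (suc d))
  Δ : Fin m → Fin m → Fin m → Bool
  Δ a b c = h a c xor h b c
  byHalves : ∀ {a b} {l r : Fin m → Bool} →
             (∀ c → (H a (c ↑ˡ m) xor H b (c ↑ˡ m)) ≡ l c) →
             (∀ c → (H a (m ↑ʳ c) xor H b (m ↑ʳ c)) ≡ r c) →
             count (λ z → H a z xor H b z) ≡ count l + count r
  byHalves {a} {b} l≗ r≗ =
    trans (count-halves {m} (λ z → H a z xor H b z)) (cong₂ _+_ (count-cong l≗) (count-cong r≗))
  orthogonal : ∀ {a b} → Half m a → Half m b → a ≢ b → count (λ z → H a z xor H b z) ≡ order (suc d)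
  orthogonal (left a) (left b) a≢b =
    trans (byHalves (λ c → cong₂ _xor_ (hadamard-ˡˡ (suc d) a c) (hadamard-ˡˡ (suc d) b c))
                    (λ c → cong₂ _xor_ (hadamard-ˡʳ (suc d) a c) (hadamard-ˡʳ (suc d) b c)))
          (cong₂ _+_ ih ih)
    where ih = hadamard-orthogonal d (a≢b ∘ cong (_↑ˡ m))
  orthogonal (right a) (right b) a≢b =
    trans (byHalves (λ c → cong₂ _xor_ (hadamard-ʳˡ (suc d) a c) (hadamard-ʳˡ (suc d) b c))
                    (λ c → trans (cong₂ _xor_ (hadamard-ʳʳ (suc d) a c) (hadamard-ʳʳ (suc d) b c))
                                 (xor-annihilates-not (h a c) (h b c))))
          (cong₂ _+_ ih ih)
    where ih = hadamard-orthogonal d (a≢b ∘ cong (m ↑ʳ_))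
  orthogonal (left a) (right b) _ =
    trans (byHalves (λ c → cong₂ _xor_ (hadamard-ˡˡ (suc d) a c) (hadamard-ʳˡ (suc d) b c))
                    (λ c → trans (cong₂ _xor_ (hadamard-ˡʳ (suc d) a c) (hadamard-ʳʳ (suc d) b c))
                                 (≡.sym (not-distribʳ-xor (h a c) (h b c)))))
          (count-not (Δ a b))
  orthogonal (right a) (left b) _ =
    trans (byHalves (λ c → cong₂ _xor_ (hadamard-ʳˡ (suc d) a c) (hadamard-ˡˡ (suc d) b c))
                    (λ c → trans (cong₂ _xor_ (hadamard-ʳʳ (suc d) a c) (hadamard-ˡʳ (suc d) b c))
                                 (≡.sym (not-distribˡ-xor (h a c) (h b c)))))
          (count-not (Δ a b))

origin : ∀ d → Fin (order d)
origin zero    = zero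
origin (suc d) = origin d ↑ˡ order d

hadamard-origin : ∀ d z → hadamard d (origin d) z ≡ false
hadamard-origin zero    z = refl
hadamard-origin (suc d) z with half (order d) z
... | left c  = trans (hadamard-ˡˡ d (origin d) c) (hadamard-origin d c)
... | right c = trans (hadamard-ˡʳ d (origin d) c) (hadamard-origin d c)

hadamard-rowCount : ∀ d {a} → a ≢ origin (suc d) → count (hadamard (suc d) a) ≡ order d
hadamard-rowCount d {a} a≢o = trans (count-cong against-origin) (hadamard-orthogonal d a≢o)
  where
  against-origin : ∀ z → hadamard (suc d) a z ≡ (hadamard (suc d) a z xor hadamard (suc d) (origin (suc d)) z)
  against-origin z = ≡.sym (trans (cong (hadamard (suc d) a z xor_) (hadamard-origin (suc d) z)) (xor-identityʳ _))

hadamard-row≤ : ∀ d a → count (hadamard (suc d) a) ≤ order d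
hadamard-row≤ d a with a ≟ origin (suc d)
... | yes refl =
  subst (_≤ order d) (≡.sym (trans (count-cong (hadamard-origin (suc d))) (count-false (order (suc d))))) z≤n
... | no  a≢o  = ≤-reflexive (hadamard-rowCount d a≢o)

hadamard-row≥ : ∀ d a → order d ≤ count (not ∘ hadamard (suc d) a)
hadamard-row≥ d a = +-cancelˡ-≤ (order d) _ _ (begin
  order d + order d                                                   ≡⟨ count-not (hadamard (suc d) a) ⟨
  count (hadamard (suc d) a) + count (not ∘ hadamard (suc d) a)       ≤⟨ +-monoˡ-≤ _ (hadamard-row≤ d a) ⟩
  order d + count (not ∘ hadamard (suc d) a)                          ∎)
  where open ≤-Reasoning

withApex : ∀ {n} → (Fin n → Fin n → Bool) → Fin (suc n) → Fin (suc n) → Bool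
withApex M zero    _       = true
withApex M (suc x) zero    = true
withApex M (suc x) (suc y) = M x y

withApex-sym : ∀ {n} {M : Fin n → Fin n → Bool} →
               (∀ x y → M x y ≡ M y x) → ∀ x y → withApex M x y ≡ withApex M y x
withApex-sym M-sym zero    zero    = refl
withApex-sym M-sym zero    (suc y) = refl
withApex-sym M-sym (suc x) zero    = refl
withApex-sym M-sym (suc x) (suc y) = M-sym x y

hadamardGraph : ∀ d → Graph (suc (order (suc d)))
hadamardGraph d = simpleGraph (withApex (hadamard (suc d))) (withApex-sym (hadamard-sym (suc d)))

hadamardGraph-distinguishers : ∀ d {u v} → u ≢ v → order d ∸ 2 ≤ count (distinguishers (hadamardGraph d) u v)
hadamardGraph-distinguishers d {u} {v} u≢v =
  m≤n+o⇒m∸n≤o (order d) 2 (≤-trans (≤-trans (rows u≢v) (m≤n+m _ _)) (distinguishers-simpleGraph M M-sym u v))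
  where
  H = hadamard (suc d)
  M = withApex H
  M-sym = withApex-sym (hadamard-sym (suc d))
  rows : ∀ {u v} → u ≢ v → order d ≤ count (λ z → M u (suc z) xor M v (suc z))
  rows {zero}  {zero}  u≢v = ⊥-elim (u≢v refl)
  rows {zero}  {suc b} _   = hadamard-row≥ d b
  rows {suc a} {zero}  _   = subst (order d ≤_) (count-cong (λ z → xor-comm true (H a z))) (hadamard-row≥ d a)
  rows {suc a} {suc b} u≢v = ≤-reflexive (≡.sym (hadamard-orthogonal d (u≢v ∘ cong suc)))

hadamardGraph-twinWidth : ∀ d → TwinWidthAtLeast (hadamardGraph d) (order d ∸ 2)
hadamardGraph-twinWidth d =
  twinWidth≥ (hadamardGraph d) (≤-trans (s≤s z≤n) (n<order (suc d))) (hadamardGraph-distinguishers d)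

dropApex : ∀ {n} → (Fin (suc n) → Fin (suc n) → Bool) → Fin (suc n) → Fin (suc n) → Bool
dropApex R zero    _       = false
dropApex R (suc x) zero    = false
dropApex R (suc x) (suc y) = R (suc x) (suc y)

hadamardEdges : ∀ d → EdgeSet (hadamardGraph d)
hadamardEdges d = record { mem = dropApex (adj G) ; msym = symmetric ; sub = ⊆adj }
  where
  G = hadamardGraph d
  symmetric : ∀ x y → dropApex (adj G) x y ≡ dropApex (adj G) y x
  symmetric zero    zero    = refl
  symmetric zero    (suc y) = refl
  symmetric (suc x) zero    = refl
  symmetric (suc x) (suc y) = Graph.sym G (suc x) (suc y)
  ⊆adj : ∀ x y → dropApex (adj G) x y ≡ true → adj G x y ≡ true
  ⊆adj (suc x) (suc y) e = e

module _ (d : ℕ) where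
  private
    G = hadamardGraph d
    F = hadamardEdges d
    P = order (suc d)

  hadamardGraph-star : ∀ {x y} → adj (G ─ F) x y ≡ true → x ≡ zero ⊎ y ≡ zero
  hadamardGraph-star {zero}  {_}     _ = inj₁ refl
  hadamardGraph-star {suc x} {zero}  _ = inj₂ refl
  hadamardGraph-star {suc x} {suc y} e with () ← trans (≡.sym (∧-inverseʳ (adj G (suc x) (suc y)))) e

  hadamardGraph-spanningStar : countPairs (adj (G ─ F)) ≡ P
  hadamardGraph-spanningStar = begin
    countPairs (adj (G ─ F))                    ≡⟨ countPairs-∑ (adj (G ─ F)) ⟩
    count {P} (λ _ → true) + ∑[ i < P ] count (λ j → (toℕ (suc i) <ᵇ toℕ j) ∧ adj (G ─ F) (suc i) j)
                                                ≡⟨ cong₂ _+_ (count-true P) (trans (sum-cong-≗ leafRow) (sum-replicate-zero P)) ⟩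
    P + 0                                       ≡⟨ +-identityʳ P ⟩
    P                                           ∎
    where
    open ≡-Reasoning
    leafRow : ∀ i → count (λ j → (toℕ (suc i) <ᵇ toℕ j) ∧ adj (G ─ F) (suc i) j) ≡ 0
    leafRow i = trans (count-cong {p = row} noEdge) (count-false (suc P))
      where
      row : Fin (suc P) → Bool
      row j = (toℕ (suc i) <ᵇ toℕ j) ∧ adj (G ─ F) (suc i) j
      noEdge : ∀ j → row j ≡ false
      noEdge zero    = refl
      noEdge (suc j) = trans (cong ((toℕ i <ᵇ toℕ j) ∧_) (∧-inverseʳ (adj G (suc i) (suc j)))) (∧-zeroʳ _)

  hadamardGraph-acyclic : Acyclic (G ─ F)
  hadamardGraph-acyclic = star⇒acyclic (G ─ F) zero hadamardGraph-star

  hadamardGraph-FEN : IsFeedbackEdgeNumber G (size F)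
  hadamardGraph-FEN = spanningTree⇒isFeedbackEdgeNumber G F hadamardGraph-acyclic hadamardGraph-spanningStar

  hadamardEdges-size≤ : size F ≤ order d * order d
  hadamardEdges-size≤ = *-cancelˡ-≤ 2 (begin
    2 * size F
      ≡⟨ count₂-edgeSet F ⟨
    count (mem F zero) + ∑[ x < P ] count (mem F (suc x))
      ≤⟨ +-mono-≤ (≤-reflexive (count-false (suc P))) (∑-≤-* row≤) ⟩
    (order d + order d) * order d
      ≡⟨ *-distribʳ-+ (order d) (order d) (order d) ⟩
    order d * order d + order d * order d
      ≡⟨ cong (order d * order d +_) (+-identityʳ _) ⟨
    2 * (order d * order d) ∎)
    where
    open ≤-Reasoning
    row≤ : ∀ x → count (mem F (suc x)) ≤ order d
    row≤ x = ≤-trans (count-mono {p = mem F (suc x) ∘ suc} (proj₁ ∘ Equivalence.to (T-∧ {hadamard (suc d) x _})))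
                     (hadamard-row≤ d x)

  hadamardEdges-size≥ : order d ≤ suc (2 * size F)
  hadamardEdges-size≥ = begin
    order d                      ≡⟨ hadamard-rowCount d far ⟨
    count (hadamard (suc d) r)   ≤⟨ count-except r (λ y≢r hy → Equivalence.from T-∧ (hy , ≢⇒T-not-== (y≢r ∘ ≡.sym))) ⟩
    suc (count (mem F (suc r)))  ≤⟨ s≤s (≤-∑ (count ∘ mem F) (suc r)) ⟩
    suc (count₂ (mem F))         ≡⟨ cong suc (count₂-edgeSet F) ⟩
    suc (2 * size F)             ∎
    where
    open ≤-Reasoning
    r = order d ↑ʳ origin d
    far : r ≢ origin (suc d)
    far e with () ← trans (≡.sym (splitAt-↑ʳ (order d) (order d) (origin d)))
                          (trans (cong (splitAt (order d)) e) (splitAt-↑ˡ (order d) (origin d) (order d)))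

⌊√_⌋ : ℕ → ℕ
⌊√ zero ⌋  = zero
⌊√ suc k ⌋ with suc ⌊√ k ⌋ * suc ⌊√ k ⌋ ≤? suc k
... | yes _ = suc ⌊√ k ⌋
... | no  _ = ⌊√ k ⌋

⌊√⌋-bounds : ∀ k → ⌊√ k ⌋ * ⌊√ k ⌋ ≤ k × k < suc ⌊√ k ⌋ * suc ⌊√ k ⌋
⌊√⌋-bounds zero = z≤n , s≤s z≤n
⌊√⌋-bounds (suc k) with suc ⌊√ k ⌋ * suc ⌊√ k ⌋ ≤? suc k | ⌊√⌋-bounds k
... | yes s²≤ | _ , k<s² = s²≤ , ≤-<-trans k<s² (*-mono-< (n<1+n (suc ⌊√ k ⌋)) (n<1+n (suc ⌊√ k ⌋)))
... | no  s²≰ | s²≤ , _  = ≤-trans s²≤ (n≤1+n k) , ≰⇒> s²≰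

⌊√⌋-≤ : ∀ {k h} → k ≤ h * h → ⌊√ k ⌋ ≤ h
⌊√⌋-≤ {k} k≤h² = ≮⇒≥ λ h<s → <⇒≱ (*-mono-< h<s h<s) (≤-trans (proj₁ (⌊√⌋-bounds k)) k≤h²)

⌊√⌋∸2-omega : OmegaSqrt (λ k → ⌊√ k ⌋ ∸ 2)
⌊√⌋∸2-omega = 1 , 4 , 9 , s≤s z≤n , s≤s z≤n , bound
  where
  bound : ∀ k → 9 ≤ k → 1 * 1 * k ≤ 4 * 4 * ((⌊√ k ⌋ ∸ 2) * (⌊√ k ⌋ ∸ 2))
  bound k 9≤k with ⌊√ k ⌋ | proj₂ (⌊√⌋-bounds k)
  ... | 0 | k<1 = ⊥-elim (<⇒≱ k<1 (≤-trans (m≤m+n 1 8) 9≤k))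
  ... | 1 | k<4 = ⊥-elim (<⇒≱ k<4 (≤-trans (m≤m+n 4 5) 9≤k))
  ... | 2 | k<9 = ⊥-elim (<⇒≱ k<9 9≤k)
  -- with s = ⌊√k⌋ ≥ 3:  k < (s + 1)² ≤ 16 (s − 2)²
  ... | suc (suc (suc t)) | k<s² = begin
    1 * 1 * k                     ≡⟨ *-identityˡ k ⟩
    k                             ≤⟨ <⇒≤ k<s² ⟩
    (4 + t) * (4 + t)             ≤⟨ *-mono-≤ 4+t≤4[1+t] 4+t≤4[1+t] ⟩
    (4 * suc t) * (4 * suc t)     ≡⟨ [m*n]*[o*p]≡[m*o]*[n*p] 4 (suc t) 4 (suc t) ⟩
    4 * 4 * (suc t * suc t)       ∎
    where
    open ≤-Reasoning
    4+t≤4[1+t] : 4 + t ≤ 4 * suc t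
    4+t≤4[1+t] = subst (4 + t ≤_) (≡.sym (*-suc 4 t)) (+-monoʳ-≤ 4 (m≤n*m t 4))

data IsHadamardGraph : GraphClass where
  hadamard-graph : ∀ d → IsHadamardGraph (suc (order (suc d))) (hadamardGraph d)

hadamardGraphs-unboundedFEN : UnboundedFEN IsHadamardGraph
hadamardGraphs-unboundedFEN N =
  _ , hadamardGraph (2 * N) , hadamard-graph (2 * N) , size (hadamardEdges (2 * N)) , hadamardGraph-FEN (2 * N) ,
  *-cancelˡ-≤ 2 (s≤s⁻¹ (≤-trans (n<order (2 * N)) (hadamardEdges-size≥ (2 * N))))

proposition9 : Σ (ℕ → ℕ) λ f → OmegaSqrt f × Σ GraphClass λ 𝒢 → UnboundedFEN 𝒢 ×
    (∀ n (G : Graph n) → 𝒢 n G → ∀ k → IsFeedbackEdgeNumber G k → TwinWidthAtLeast G (f k))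
proposition9 =
  (λ k → ⌊√ k ⌋ ∸ 2) , ⌊√⌋∸2-omega , IsHadamardGraph , hadamardGraphs-unboundedFEN , twinWidth
  where
  twinWidth : ∀ n (G : Graph n) → IsHadamardGraph n G →
              ∀ k → IsFeedbackEdgeNumber G k → TwinWidthAtLeast G (⌊√ k ⌋ ∸ 2)
  twinWidth _ _ (hadamard-graph d) k (_ , minimum) =
    TwinWidthAtLeast-mono (∸-monoˡ-≤ 2 (⌊√⌋-≤ {h = order d} k≤h²)) (hadamardGraph-twinWidth d)
    where
    k≤h² : k ≤ order d * order d
    k≤h² = ≤-trans (minimum (hadamardEdges d) (hadamardGraph-acyclic d)) (hadamardEdges-size≤ d)
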